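{- Let $k$ be a positive integer, $m=2^{k-1}$, and assume $m\ge 4$. Let $\Phi$ be the map defined below. If $\mathcal C\subseteq Z_{2m}^n$ is an $(n,M,d)^\diamond$-code, then $\Phi(\mathcal C)$ is a binary $\big(mn,\ M\,(2^m/2m)^n,\ \min(4,d)\big)$-code.
   Context: A binary $(N,M,d)$-code is a subset of $Z_2^N$ of cardinality $M$ with Hamming distance at least $d$ between any two distinct elements; an extended $1$-perfect $(m,2^m/2m,4)$-code is such a code with these parameters. Let $\{H_0,\dots,H_{2m-1}\}$ be a partition of $Z_2^m$ into extended $1$-perfect $(m,2^m/2m,4)$-codes such that $H_0$ contains the all-zero word and, for each $j$, all words of $H_j$ have Hamming weight of the same parity as $j$. Define $\Phi(x_1,\dots,x_n)=H_{x_1}\times\dots\times H_{x_n}\subseteq Z_2^{mn}$ for $(x_1,\dots,x_n)\in Z_{2m}^n$, and for $\mathcal C\subseteq Z_{2m}^n$ put $\Phi(\mathcal C)=\bigcup_{\bar x\in\mathcal C}\Phi(\bar x)$. Define $wt^\diamond:Z_{2m}\to\mathbb R_{\ge0}$ by $wt^\diamond(0)=0$, $wt^\diamond(x)=1$ for odd $x$, $wt^\diamond(x)=2$ for even $x\ne0$, and $d^\diamond(\bar x,\bar y)=\sum_{i=1}^n wt^\diamond(y_i-x_i)$. A set $\mathcal C\subseteq Z_{2m}^n$ is an $(n,M,d)^\diamond$-code if $|\mathcal C|=M$ and the $d^\diamond$-distance between any two distinct elements is at least $d$. -}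

module Defs where

open import Data.Nat using (ℕ; zero; suc; _+_; _*_; _∸_; _^_; _≤_; _%_; _/_)
open import Data.Bool using (Bool; true; false)
open import Data.Fin using (Fin; toℕ)
open import Data.Vec using (Vec; []; _∷_; lookup; concat; replicate)
open import Data.List using (List; length)
open import Data.List.Relation.Unary.All using (All)
open import Data.List.Relation.Unary.Unique.Propositional using (Unique)
open import Data.List.Membership.Propositional using (_∈_)
open import Data.Product using (Σ; ∃; _×_; _,_)
open import Relation.Binary.PropositionalEquality using (_≡_; _≢_)

weight : ∀ {N} → Vec Bool N → ℕ
weight []           = 0
weight (true  ∷ xs) = suc (weight xs)
weight (false ∷ xs) = weight xs

hamming : ∀ {N} → Vec Bool N → Vec Bool N → ℕ
hamming []       []       = 0
hamming (false ∷ xs) (false ∷ ys) = hamming xs ys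
hamming (true  ∷ xs) (true  ∷ ys) = hamming xs ys
hamming (false ∷ xs) (true  ∷ ys) = suc (hamming xs ys)
hamming (true  ∷ xs) (false ∷ ys) = suc (hamming xs ys)

HasSize : {A : Set} → (A → Set) → ℕ → Set
HasSize {A} P M =
  Σ (List A) λ l → Unique l × All P l × (∀ x → P x → x ∈ l) × length l ≡ M

IsBinCode : (N M d : ℕ) → (Vec Bool N → Set) → Set
IsBinCode N M d P =
  HasSize P M × (∀ x y → P x → P y → x ≢ y → d ≤ hamming x y)

-- the size 2^m / 2m of an extended 1-perfect code of length m
perfSize : ℕ → ℕ
perfSize zero    = 0
perfSize (suc m) = 2 ^ suc m / (2 * suc m)

-- y - x in Z_N, as a natural number in [0, N)
subMod : ∀ {N} → Fin N → Fin N → ℕ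
subMod {suc N} x y = (toℕ y + (suc N ∸ toℕ x)) % suc N

wtN : ℕ → ℕ
wtN zero = 0
wtN (suc a) with suc a % 2
... | zero  = 2
... | suc _ = 1

wt◇ : ∀ {N} → Fin N → Fin N → ℕ
wt◇ x y = wtN (subMod x y)

d◇ : ∀ {N n} → Vec (Fin N) n → Vec (Fin N) n → ℕ
d◇ []       []       = 0
d◇ (x ∷ xs) (y ∷ ys) = wt◇ x y + d◇ xs ys

IsDCode : (N n M d : ℕ) → (Vec (Fin N) n → Set) → Set
IsDCode N n M d C =
  HasSize C M × (∀ x y → C x → C y → x ≢ y → d ≤ d◇ x y)

IsGoodPartition : (m : ℕ) → (Fin (2 * m) → Vec Bool m → Set) → Set
IsGoodPartition m H =
    (∀ w → ∃ λ j → H j w)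
  × (∀ w i j → H i w → H j w → i ≡ j)
  × (∀ j → IsBinCode m (perfSize m) 4 (H j))
  × (∀ (j : Fin (2 * m)) → (z : toℕ j ≡ 0) → H j (replicate m false))
  × (∀ j w → H j w → weight w % 2 ≡ toℕ j % 2)

Φ : ∀ {m n} → (Fin (2 * m) → Vec Bool m → Set)
    → (Vec (Fin (2 * m)) n → Set) → Vec Bool (n * m) → Set
Φ {m} {n} H C w =
  ∃ λ (xs : Vec (Fin (2 * m)) n) → C xs ×
  ∃ λ (bs : Vec (Vec Bool m) n) → w ≡ concat bs ×
  (∀ i → H (lookup xs i) (lookup bs i))

-- Since the H_j partition Z_2^m, a word of Φ(C) determines its index x̄ and its blocks,
-- so Φ(C) is a disjoint union of M products of n codes of size 2^m/2m. Two words with the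
-- same index differ in a block lying in one code H_{x_i}, hence in at least 4 positions.
-- For different indices compare blockwise: if a ∈ H_i and b ∈ H_j then
-- hamming a b ≥ wt◇(j − i), because distance 0 forces a = b and so i = j, distance 1
-- forces weights of different parity and so j − i odd, and wt◇ never exceeds 2.
-- Summing over the blocks gives a distance of at least d◇(x̄, ȳ) ≥ d.
module Submission where

open import Defs
open import Data.Nat using (ℕ; zero; suc; _+_; _*_; _∸_; _^_; _≤_; _⊓_; _%_; z≤n; s≤s)
open import Data.Nat.Properties
open import Data.Nat.DivMod using (m∣n⇒o%n%m≡o%m; [m+kn]%n≡m%n; %-distribˡ-+; n%n≡0)
open import Data.Nat.Divisibility using (divides)
open import Data.Nat.Tactic.RingSolver using (solve-∀)
open import Data.Bool using (Bool; true; false)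
import Data.Bool as Bool
open import Data.Fin using (Fin; toℕ; zero; suc)
import Data.Fin.Properties as Fin
open import Data.Vec using (Vec; []; _∷_; lookup; concat; _++_; tabulate)
open import Data.Vec.Properties using (tabulate∘lookup; tabulate-cong; ∷-injectiveˡ; ∷-injectiveʳ; ++-injectiveˡ; ++-injectiveʳ; ≡-dec)
open import Data.List using (List; length; map; concatMap) renaming ([] to []ₗ; _∷_ to _∷ₗ_; [_] to [_]ₗ)
open import Data.List.Properties using (length-++; length-map)
open import Data.List.Relation.Unary.All as All using (All) renaming ([] to []ᵃ; _∷_ to _∷ᵃ_)
import Data.List.Relation.Unary.All.Properties as All
open import Data.List.Relation.Unary.Any using (here)
import Data.List.Relation.Unary.Any as Any
import Data.List.Relation.Unary.AllPairs as AllPairs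
import Data.List.Relation.Unary.AllPairs.Properties as AllPairs
open import Data.List.Relation.Unary.Unique.Propositional using (Unique)
import Data.List.Relation.Unary.Unique.Propositional.Properties as Unique
open import Data.List.Membership.Propositional using (_∈_)
open import Data.List.Relation.Binary.Disjoint.Propositional using (Disjoint)
open import Data.List.Membership.Propositional.Properties using (∈-map⁺; ∈-concatMap⁺)
open import Data.Product using (∃; _×_; _,_; proj₁; proj₂)
open import Data.Empty using (⊥-elim)
open import Function using (_∘_; _⇔_; Equivalence; mk⇔)
open import Function.Definitions using (Injective)
open import Relation.Nullary using (yes; no)
open import Relation.Binary.PropositionalEquality

module Enumeration {A : Set} {P : A → Set} {M : ℕ} (s : HasSize P M) where

  list : List A
  list = proj₁ s

  unique : Unique list
  unique = proj₁ (proj₂ s)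

  all : All P list
  all = proj₁ (proj₂ (proj₂ s))

  complete : ∀ a → P a → a ∈ list
  complete = proj₁ (proj₂ (proj₂ (proj₂ s)))

  length≡ : length list ≡ M
  length≡ = proj₂ (proj₂ (proj₂ (proj₂ s)))

Image : {A B : Set} → (A → B) → (A → Set) → B → Set
Image f P b = ∃ λ a → b ≡ f a × P a

⋃ : {X A : Set} → (X → Set) → (X → A → Set) → A → Set
⋃ C P a = ∃ λ x → C x × P x a

HasSize-resp : {A : Set} {P Q : A → Set} {M : ℕ} →
               (∀ a → P a ⇔ Q a) → HasSize P M → HasSize Q M
HasSize-resp P⇔Q (l , unique , all , complete , len) =
  l , unique , All.map (Equivalence.to (P⇔Q _)) all ,
  (λ a q → complete a (Equivalence.from (P⇔Q a) q)) , len

HasSize-Image : {A B : Set} {P : A → Set} {M : ℕ} (f : A → B) →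
                Injective _≡_ _≡_ f → HasSize P M → HasSize (Image f P) M
HasSize-Image f f-inj (l , unique , all , complete , len) =
  map f l ,
  Unique.map⁺ f-inj unique ,
  All.map⁺ (All.map (λ {a} p → a , refl , p) all) ,
  (λ { _ (a , refl , p) → ∈-map⁺ f (complete a p) }) ,
  trans (length-map f l) len

HasSize-⋃ : {X A : Set} {C : X → Set} {P : X → A → Set} {M q : ℕ} →
            HasSize C M → (∀ x → HasSize (P x) q) →
            (∀ x y a → P x a → P y a → x ≡ y) → HasSize (⋃ C P) (M * q)
HasSize-⋃ {X} {A} {C} {P} {q = q} (lC , uniqueC , allC , completeC , refl) sizeP P-disjoint =
  concatMap list lC , unique , all allC , complete , length-concatMap lC
  where
  list : X → List A
  list x = Enumeration.list (sizeP x)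

  disjoint : ∀ {x y} → x ≢ y → Disjoint (list x) (list y)
  disjoint {x} {y} x≢y (a∈x , a∈y) = x≢y (P-disjoint x y _
    (All.lookup (Enumeration.all (sizeP x)) a∈x) (All.lookup (Enumeration.all (sizeP y)) a∈y))

  unique : Unique (concatMap list lC)
  unique = Unique.concat⁺
    (All.map⁺ (All.tabulate (λ {x} _ → Enumeration.unique (sizeP x))))
    (AllPairs.map⁺ (AllPairs.map disjoint uniqueC))

  all : ∀ {l} → All C l → All (⋃ C P) (concatMap list l)
  all []ᵃ = []ᵃ
  all {x ∷ₗ _} (cx ∷ᵃ cs) =
    All.++⁺ (All.map (λ p → x , cx , p) (Enumeration.all (sizeP x))) (all cs)

  complete : ∀ a → ⋃ C P a → a ∈ concatMap list lC
  complete a (x , cx , p) = ∈-concatMap⁺ list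
    (Any.map (λ { refl → Enumeration.complete (sizeP x) a p }) (completeC x cx))

  length-concatMap : ∀ l → length (concatMap list l) ≡ length l * q
  length-concatMap []ₗ = refl
  length-concatMap (x ∷ₗ l) = trans (length-++ (list x))
    (cong₂ _+_ (Enumeration.length≡ (sizeP x)) (length-concatMap l))

-- The paper's H_{x_1} × ⋯ × H_{x_n} as a set of block tuples; Φ H C unfolds to
-- ⋃ C (λ x̄ → Image concat (Blocks H x̄)).
Blocks : {F B : Set} {n : ℕ} → (F → B → Set) → Vec F n → Vec B n → Set
Blocks H xs bs = ∀ i → H (lookup xs i) (lookup bs i)

⋃-Image-∷⇔Blocks : {F B : Set} {n : ℕ} (H : F → B → Set) (x : F) (xs : Vec F n) (bs : Vec B (suc n)) →
                   ⋃ (H x) (λ b → Image (b ∷_) (Blocks H xs)) bs ⇔ Blocks H (x ∷ xs) bs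
⋃-Image-∷⇔Blocks H x xs (b ∷ bs) = mk⇔
  (λ { (_ , hb , _ , refl , g) → λ { zero → hb ; (suc i) → g i } })
  (λ g → b , g zero , bs , refl , g ∘ suc)

HasSize-Blocks : {F B : Set} {H : F → B → Set} {p : ℕ} →
                 (∀ x → HasSize (H x) p) → ∀ {n} (xs : Vec F n) → HasSize (Blocks H xs) (p ^ n)
HasSize-Blocks sizeH [] =
  [ [] ]ₗ , []ᵃ AllPairs.∷ AllPairs.[] , (λ ()) ∷ᵃ []ᵃ , (λ { [] _ → here refl }) , refl
HasSize-Blocks {H = H} sizeH (x ∷ xs) =
  HasSize-resp (⋃-Image-∷⇔Blocks H x xs)
    (HasSize-⋃ (sizeH x) (λ b → HasSize-Image (b ∷_) ∷-injectiveʳ (HasSize-Blocks sizeH xs))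
      (λ { _ _ _ (_ , refl , _) (_ , e , _) → ∷-injectiveˡ e }))

Blocks-functional : {F B : Set} {n : ℕ} {H : F → B → Set} → (∀ b x y → H x b → H y b → x ≡ y) →
                    ∀ {xs ys : Vec F n} {bs} → Blocks H xs bs → Blocks H ys bs → xs ≡ ys
Blocks-functional H-disjoint {xs} {ys} g h = begin
  xs                  ≡⟨ tabulate∘lookup xs ⟨
  tabulate (lookup xs) ≡⟨ tabulate-cong (λ i → H-disjoint _ _ _ (g i) (h i)) ⟩
  tabulate (lookup ys) ≡⟨ tabulate∘lookup ys ⟩
  ys                  ∎
  where open ≡-Reasoning

concat-injective : ∀ {A : Set} {m n} → Injective _≡_ _≡_ (concat {A = A} {m = m} {n = n})
concat-injective {x = []} {[]} _ = refl
concat-injective {x = b ∷ bs} {c ∷ cs} e =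
  cong₂ _∷_ (++-injectiveˡ b c e) (concat-injective (++-injectiveʳ b c e))

HasSize-Φ : ∀ {m n p M} (H : Fin (2 * m) → Vec Bool m → Set) (C : Vec (Fin (2 * m)) n → Set) →
            (∀ j → HasSize (H j) p) → (∀ w i j → H i w → H j w → i ≡ j) →
            HasSize C M → HasSize (Φ H C) (M * p ^ n)
HasSize-Φ H C sizeH H-disjoint sizeC =
  HasSize-⋃ sizeC (λ xs → HasSize-Image concat concat-injective (HasSize-Blocks sizeH xs))
    λ { _ ys _ (bs , refl , g) (cs , e , h) →
          Blocks-functional H-disjoint {bs = bs} g
            (subst (Blocks H ys) (sym (concat-injective {x = bs} {y = cs} e)) h) }

hamming-++ : ∀ {a b} (x y : Vec Bool a) (u v : Vec Bool b) →
             hamming (x ++ u) (y ++ v) ≡ hamming x y + hamming u v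
hamming-++ []          []          u v = refl
hamming-++ (false ∷ x) (false ∷ y) u v = hamming-++ x y u v
hamming-++ (true  ∷ x) (true  ∷ y) u v = hamming-++ x y u v
hamming-++ (false ∷ x) (true  ∷ y) u v = cong suc (hamming-++ x y u v)
hamming-++ (true  ∷ x) (false ∷ y) u v = cong suc (hamming-++ x y u v)

hamming≡0⇒≡ : ∀ {N} (x y : Vec Bool N) → hamming x y ≡ 0 → x ≡ y
hamming≡0⇒≡ []          []          _ = refl
hamming≡0⇒≡ (false ∷ x) (false ∷ y) e = cong (false ∷_) (hamming≡0⇒≡ x y e)
hamming≡0⇒≡ (true  ∷ x) (true  ∷ y) e = cong (true ∷_) (hamming≡0⇒≡ x y e)

weight+weight≡even+hamming : ∀ {N} (x y : Vec Bool N) →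
                             ∃ λ c → weight x + weight y ≡ c * 2 + hamming x y
weight+weight≡even+hamming [] [] = 0 , refl
weight+weight≡even+hamming (false ∷ x) (false ∷ y) = weight+weight≡even+hamming x y
weight+weight≡even+hamming (true ∷ x) (true ∷ y) with weight+weight≡even+hamming x y
... | c , e = suc c , cong suc (trans (+-suc (weight x) (weight y)) (cong suc e))
weight+weight≡even+hamming (false ∷ x) (true ∷ y) with weight+weight≡even+hamming x y
... | c , e = c , trans (+-suc (weight x) (weight y)) (trans (cong suc e) (sym (+-suc (c * 2) _)))
weight+weight≡even+hamming (true ∷ x) (false ∷ y) with weight+weight≡even+hamming x y
... | c , e = c , trans (cong suc e) (sym (+-suc (c * 2) _))

hamming%2 : ∀ {N} (x y : Vec Bool N) → hamming x y % 2 ≡ (weight x + weight y) % 2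
hamming%2 x y with weight+weight≡even+hamming x y
... | c , e = begin
  hamming x y % 2           ≡⟨ [m+kn]%n≡m%n (hamming x y) c 2 ⟨
  (hamming x y + c * 2) % 2 ≡⟨ cong (_% 2) (trans (+-comm (hamming x y) (c * 2)) (sym e)) ⟩
  (weight x + weight y) % 2 ∎
  where open ≡-Reasoning

subMod-self : ∀ {N} (i : Fin N) → subMod i i ≡ 0
subMod-self {suc N} i = trans (cong (_% suc N) (m+[n∸m]≡n (<⇒≤ (Fin.toℕ<n i)))) (n%n≡0 (suc N))

subMod-parity : ∀ m (i j : Fin (2 * suc m)) → subMod i j % 2 ≡ (toℕ i + toℕ j) % 2
subMod-parity m i j = begin
  subMod i j % 2                 ≡⟨ m∣n⇒o%n%m≡o%m 2 N (j′ + (N ∸ i′)) (divides (suc m) (*-comm 2 (suc m))) ⟩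
  (j′ + (N ∸ i′)) % 2            ≡⟨ [m+kn]%n≡m%n (j′ + (N ∸ i′)) i′ 2 ⟨
  (j′ + (N ∸ i′) + i′ * 2) % 2   ≡⟨ cong (_% 2) (rearrange j′ (N ∸ i′) i′) ⟩
  (i′ + j′ + (N ∸ i′ + i′)) % 2  ≡⟨ cong (λ t → (i′ + j′ + t) % 2) (m∸n+n≡m (<⇒≤ (Fin.toℕ<n i))) ⟩
  (i′ + j′ + N) % 2              ≡⟨ cong (λ t → (i′ + j′ + t) % 2) (*-comm 2 (suc m)) ⟩
  (i′ + j′ + suc m * 2) % 2      ≡⟨ [m+kn]%n≡m%n (i′ + j′) (suc m) 2 ⟩
  (i′ + j′) % 2                  ∎
  where
  open ≡-Reasoning
  N = 2 * suc m
  i′ = toℕ i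
  j′ = toℕ j
  rearrange : ∀ a b c → a + b + c * 2 ≡ c + a + (b + c)
  rearrange = solve-∀

wtN≤2 : ∀ s → wtN s ≤ 2
wtN≤2 zero = z≤n
wtN≤2 (suc a) with suc a % 2
... | zero  = ≤-refl
... | suc _ = s≤s z≤n

wtN-odd : ∀ s → s % 2 ≡ 1 → wtN s ≡ 1
wtN-odd (suc a) odd with suc a % 2
... | suc _ = refl

wtN≤ : ∀ s h → (h ≡ 0 → s ≡ 0) → (h ≡ 1 → s % 2 ≡ 1) → wtN s ≤ h
wtN≤ s zero          h≡0⇒s≡0 _ rewrite h≡0⇒s≡0 refl = z≤n
wtN≤ s 1             _ h≡1⇒odd = ≤-reflexive (wtN-odd s (h≡1⇒odd refl))
wtN≤ s (suc (suc h)) _ _       = ≤-trans (wtN≤2 s) (s≤s (s≤s z≤n))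

module GoodPartition {m : ℕ} {H : Fin (2 * suc m) → Vec Bool (suc m) → Set}
                     (G : IsGoodPartition (suc m) H) where

  H-disjoint : ∀ w i j → H i w → H j w → i ≡ j
  H-disjoint = proj₁ (proj₂ G)

  H-code : ∀ j → IsBinCode (suc m) (perfSize (suc m)) 4 (H j)
  H-code = proj₁ (proj₂ (proj₂ G))

  H-parity : ∀ j w → H j w → weight w % 2 ≡ toℕ j % 2
  H-parity = proj₂ (proj₂ (proj₂ (proj₂ G)))

  wt◇≤hamming : ∀ {i j a b} → H i a → H j b → wt◇ i j ≤ hamming a b
  wt◇≤hamming {i} {j} {a} {b} ha hb = wtN≤ (subMod i j) (hamming a b) distance0 distance1
    where
    open ≡-Reasoning
    distance0 : hamming a b ≡ 0 → subMod i j ≡ 0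
    distance0 e with refl ← hamming≡0⇒≡ a b e with refl ← H-disjoint a i j ha hb = subMod-self i

    distance1 : hamming a b ≡ 1 → subMod i j % 2 ≡ 1
    distance1 e = begin
      subMod i j % 2                    ≡⟨ subMod-parity m i j ⟩
      (toℕ i + toℕ j) % 2               ≡⟨ %-distribˡ-+ (toℕ i) (toℕ j) 2 ⟩
      (toℕ i % 2 + toℕ j % 2) % 2       ≡⟨ cong₂ (λ u v → (u + v) % 2) (H-parity i a ha) (H-parity j b hb) ⟨
      (weight a % 2 + weight b % 2) % 2 ≡⟨ %-distribˡ-+ (weight a) (weight b) 2 ⟨
      (weight a + weight b) % 2         ≡⟨ hamming%2 a b ⟨
      hamming a b % 2                   ≡⟨ cong (_% 2) e ⟩
      1                                 ∎

  d◇≤hamming-concat : ∀ {n} (xs ys : Vec (Fin (2 * suc m)) n) bs cs →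
                      Blocks H xs bs → Blocks H ys cs → d◇ xs ys ≤ hamming (concat bs) (concat cs)
  d◇≤hamming-concat [] [] [] [] _ _ = z≤n
  d◇≤hamming-concat (_ ∷ xs) (_ ∷ ys) (b ∷ bs) (c ∷ cs) g h
    rewrite hamming-++ b c (concat bs) (concat cs) =
    +-mono-≤ (wt◇≤hamming (g zero) (h zero)) (d◇≤hamming-concat xs ys bs cs (g ∘ suc) (h ∘ suc))

  4≤hamming-concat : ∀ {n} (xs : Vec (Fin (2 * suc m)) n) bs cs →
                     Blocks H xs bs → Blocks H xs cs → bs ≢ cs → 4 ≤ hamming (concat bs) (concat cs)
  4≤hamming-concat [] [] [] _ _ bs≢cs = ⊥-elim (bs≢cs refl)
  4≤hamming-concat (x ∷ xs) (b ∷ bs) (c ∷ cs) g h bs≢cs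
    rewrite hamming-++ b c (concat bs) (concat cs) with ≡-dec Bool._≟_ b c
  ... | yes refl = m≤n⇒m≤o+n (hamming b b)
                     (4≤hamming-concat xs bs cs (g ∘ suc) (h ∘ suc) (bs≢cs ∘ cong (b ∷_)))
  ... | no b≢c   = m≤n⇒m≤n+o (hamming (concat bs) (concat cs))
                     (proj₂ (H-code x) b c (g zero) (h zero) b≢c)

  Φ-distance : ∀ {n d} {C : Vec (Fin (2 * suc m)) n → Set} →
               (∀ xs ys → C xs → C ys → xs ≢ ys → d ≤ d◇ xs ys) →
               ∀ u v → Φ H C u → Φ H C v → u ≢ v → 4 ⊓ d ≤ hamming u v
  Φ-distance C-distance _ _ (xs , cx , bs , refl , g) (ys , cy , cs , refl , h) u≢v
    with ≡-dec Fin._≟_ xs ys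
  ... | yes refl = ≤-trans (m⊓n≤m 4 _) (4≤hamming-concat xs bs cs g h (u≢v ∘ cong concat))
  ... | no xs≢ys = ≤-trans (m⊓n≤n 4 _)
                     (≤-trans (C-distance xs ys cx cy xs≢ys) (d◇≤hamming-concat xs ys bs cs g h))

lemma1 : (k m n M d : ℕ) → 1 ≤ k → m ≡ 2 ^ (k ∸ 1) → 4 ≤ m
       → (H : Fin (2 * m) → Vec Bool m → Set) → IsGoodPartition m H
       → (C : Vec (Fin (2 * m)) n → Set) → IsDCode (2 * m) n M d C
       → IsBinCode (n * m) (M * perfSize m ^ n) (4 ⊓ d) (Φ H C)
-- Only m > 0 is used (the case m = 0 is refuted by 4 ≤ m through coverage checking).
lemma1 _ (suc m) _ _ _ _ _ _ H G C (sizeC , C-distance) =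
  HasSize-Φ H C (proj₁ ∘ H-code) H-disjoint sizeC , Φ-distance C-distance
  where open GoodPartition G
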